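{- Let $r\geq 2$ and $k\geq 1$ be integers, let $\mathcal{F}$ be a family of tents such that every $\Delta_\lambda\in\mathcal{F}$ has $\lambda$ a partition of $r$ with $r>\lambda_1\geq k$, and let $L\subseteq\{0,1,\ldots,k-1\}$. Then every $L$-intersecting $r$-uniform hypergraph $H$ satisfies $|E(H)|\leq\mathrm{ex}(|V(H)|,\mathcal{F})$ and $b(H)\leq\pi(\mathcal{F})$.
   Context: For a partition $\lambda=(\lambda_1,\ldots,\lambda_m)$ of $r$ with $r>\lambda_1\geq\cdots\geq\lambda_m$, the $\lambda$-tent $\Delta_\lambda$ is the (unique up to isomorphism) $r$-uniform hypergraph with $m+1$ edges $e_0,e_1,\ldots,e_m$ such that $|e_0\cap e_i|=\lambda_i$ for every $i$, the sets $e_0\cap e_1,\ldots,e_0\cap e_m$ partition $e_0$, and there is a vertex $v$ with $e_i\cap e_j=\{v\}$ for all $1\leq i<j\leq m$. An $r$-uniform hypergraph $H$ is $L$-intersecting if $|e\cap e'|\in L$ for all distinct $e,e'\in E(H)$. $\mathrm{ex}(n,\mathcal{F})$ is the maximum number of edges of an $r$-uniform hypergraph on $n$ vertices containing no member of $\mathcal{F}$ as a subgraph, and $\pi(\mathcal{F})=\lim_{n\to\infty}\mathrm{ex}(n,\mathcal{F})/\binom nr$. The Lagrangian is $L(H)=\max\{\sum_{e\in E(H)}\prod_{u\in e}y_u: y_u\geq 0,\ \sum_u y_u=1\}$ and the blowup density is $b(H)=r!\,L(H)$.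
   Formalization: The weights $y_u$ in the Lagrangian $L(H)$, and hence in the blowup density $b(H)$, are taken over the rationals. -}

module Defs where

open import Data.Nat as ℕ using (ℕ; zero; suc; _!)
open import Data.Nat.Combinatorics using (_C_)
open import Data.Integer using (+_)
open import Data.Rational as ℚ using (ℚ; 0ℚ; 1ℚ; _/_)
open import Data.Fin using (Fin)
open import Data.Fin.Subset using (Subset; _∩_; ∣_∣; ⋃; ⁅_⁆; Empty)
open import Data.Vec using (lookup; allFin; toList)
open import Data.Bool using (Bool; true; false; if_then_else_)
open import Data.List using (List; []; _∷_; length; map; foldr)
open import Data.Nat.ListAction using (sum)
open import Data.List.Membership.Propositional using (_∈_)
open import Data.List.Relation.Unary.All using (All)
open import Data.List.Relation.Unary.AllPairs using (AllPairs)
open import Data.List.Relation.Unary.Unique.Propositional using (Unique)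
open import Data.List.Relation.Binary.Pointwise using (Pointwise)
open import Data.Product using (Σ; ∃; ∃-syntax; _×_)
open import Relation.Binary.PropositionalEquality using (_≡_)
open import Relation.Nullary using (¬_)

record Hypergraph (r n : ℕ) : Set where
  field
    edges   : List (Subset n)
    uniform : All (λ e → ∣ e ∣ ≡ r) edges
    simple  : Unique edges
open Hypergraph public

numEdges : ∀ {r n} → Hypergraph r n → ℕ
numEdges H = length (edges H)

LIntersecting : ∀ {r n} → (ℕ → Set) → Hypergraph r n → Set
LIntersecting L H = AllPairs (λ e e' → L ∣ e ∩ e' ∣) (edges H)

IsPartition : ℕ → List ℕ → Set
IsPartition r λs = All (1 ℕ.≤_) λs × AllPairs ℕ._≥_ λs × sum λs ≡ r

TentPartition : ℕ → ℕ → List ℕ → Set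
TentPartition r k λs =
  IsPartition r λs × ∃[ l ] ∃[ ls ] (λs ≡ l ∷ ls × k ℕ.≤ l × l ℕ.< r)

IsTent : ∀ {n} → List ℕ → Subset n → List (Subset n) → Set
IsTent {n} λs e0 es =
  Pointwise (λ l e → ∣ e0 ∩ e ∣ ≡ l) λs es
  × AllPairs (λ a b → Empty ((e0 ∩ a) ∩ (e0 ∩ b))) es
  × ⋃ (map (e0 ∩_) es) ≡ e0
  × Σ (Fin n) (λ v → AllPairs (λ a b → a ∩ b ≡ ⁅ v ⁆) es)

ContainsTent : ∀ {r n} → Hypergraph r n → List ℕ → Set
ContainsTent {n = n} H λs =
  Σ (Subset n) λ e0 → Σ (List (Subset n)) λ es →
    e0 ∈ edges H × All (_∈ edges H) es × IsTent λs e0 es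

Free : ∀ {r n} → (List ℕ → Set) → Hypergraph r n → Set
Free 𝓕 H = ∀ λs → 𝓕 λs → ¬ ContainsTent H λs

IsEx : ℕ → (List ℕ → Set) → ℕ → ℕ → Set
IsEx r 𝓕 n m =
  (Σ (Hypergraph r n) λ G → Free 𝓕 G × numEdges G ≡ m)
  × ((G : Hypergraph r n) → Free 𝓕 G → numEdges G ℕ.≤ m)

ℕ→ℚ : ℕ → ℚ
ℕ→ℚ m = (+ m) / 1

-- c ≤ π(𝓕) = lim_{n→∞} ex(n,𝓕)/C(n,r), i.e.
-- for every ε > 0, eventually ex(n,𝓕) / C(n,r) ≥ c - ε (stated without division).
≤π : ℕ → (List ℕ → Set) → ℚ → Set
≤π r 𝓕 c =
  (ε : ℚ) → 0ℚ ℚ.< ε → ∃[ N ] ((n m : ℕ) → N ℕ.≤ n → IsEx r 𝓕 n m →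
     (c ℚ.- ε) ℚ.* ℕ→ℚ (n C r) ℚ.≤ ℕ→ℚ m)

InSimplex : ∀ {n} → (Fin n → ℚ) → Set
InSimplex {n} y = (∀ u → 0ℚ ℚ.≤ y u) × foldr ℚ._+_ 0ℚ (map y (toList (allFin n))) ≡ 1ℚ

edgeWeight : ∀ {n} → (Fin n → ℚ) → Subset n → ℚ
edgeWeight {n} y e =
  foldr ℚ._*_ 1ℚ (map (λ u → if lookup e u then y u else 1ℚ) (toList (allFin n)))

lagPoly : ∀ {r n} → Hypergraph r n → (Fin n → ℚ) → ℚ
lagPoly H y = foldr ℚ._+_ 0ℚ (map (edgeWeight y) (edges H))

-- b(H) = r! L(H) ≤ π(𝓕): since L(H) is the maximum of the continuous polynomial
-- lagPoly over the simplex, and rational points are dense in the simplex,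
-- this says r! · lagPoly H y ≤ π(𝓕) for every rational simplex point y.
b≤π : ∀ {r n} → (List ℕ → Set) → Hypergraph r n → Set
b≤π {r} 𝓕 H = ∀ y → InSimplex y → ≤π r 𝓕 (ℕ→ℚ (r !) ℚ.* lagPoly H y)

{-# OPTIONS --safe #-}
-- An L-intersecting H (L ⊆ {0,…,k−1}) contains no tent Δ_λ with λ₁ ≥ k: the edges e₀, e₁ of
-- such a tent share λ₁ ≥ k vertices, so they coincide, and then they share r > λ₁ vertices.
--
-- For the density, write a rational point y of the simplex as a/D and blow every vertex u of H
-- up into a part of a_u⌊n/D⌋ vertices, the blown-up edges being the transversals of the parts
-- of the edges of H. Two such edges meeting in ≥ k vertices lie over edges of H meeting in
-- ≥ k vertices, i.e. over the same edge f. So in a tent, the vertex v common to e₁, e₂, … lies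
-- in a part of f, e₀ has a vertex w in that part, and the eⱼ covering w contains both v and w;
-- a transversal meets each part once, so v = w ∈ e₀, contradicting (e₀ ∩ e₁) ∩ (e₀ ∩ e₂) = ∅.
-- Thus ex(n, 𝓕) ≥ lagPoly(H, y)·(D⌊n/D⌋)^r, and (D⌊n/D⌋)^r ≥ r!·C(n, r) − O(n^(r−1)) gives
-- r!·lagPoly(H, y) ≤ π(𝓕).
module Submission where

open import Defs

module BlowUp where
  open import Data.Bool using (true; false)
  import Data.Bool as Bool
  open import Data.Empty using (⊥-elim)
  open import Data.Fin using (Fin; zero; suc; _↑ˡ_; _↑ʳ_)
  open import Data.Fin.Properties using (0≢1+n; suc-injective)
  open import Data.Fin.Subset using (Subset; _∩_; _∈_; _∉_; _⊆_; ∣_∣; ⁅_⁆; ⋃) renaming (⊥ to ∅)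
  open import Data.Fin.Subset.Properties
    using (x∈⁅x⁆; x∈⁅y⁆⇒x≡y; ∉⊥; ∣⁅x⁆∣≡1; ∣⊥∣≡0; ∣p∩q∣≤∣p∣; ∣p∩q∣≤∣q∣;
           x∈p∩q⁺; x∈p∩q⁻; x∈p∪q⁻; ∩-comm; ∩-idem; ⊆-antisym)
  open import Data.List as List using (List; []; _∷_; length; concatMap; cartesianProductWith)
  open import Data.List.Properties using (length-++; length-map; length-tabulate; map-∘)
  open import Data.List.Membership.Propositional using (find) renaming (_∈_ to _∈ᴸ_)
  open import Data.List.Membership.Propositional.Properties
    using (∈-map⁻; ∈-cartesianProductWith⁻; ∈-concatMap⁻; ∈-tabulate⁻)
  open import Data.List.Relation.Binary.Disjoint.Propositional using (Disjoint)
  open import Data.List.Relation.Binary.Pointwise using (_∷_)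
  open import Data.List.Relation.Unary.Any using (here; there)
  open import Data.List.Relation.Unary.All as All using (All; []; _∷_)
  import Data.List.Relation.Unary.All.Properties as All
  open import Data.List.Relation.Unary.AllPairs as AllPairs using (AllPairs; []; _∷_)
  import Data.List.Relation.Unary.AllPairs.Properties as AllPairs
  open import Data.List.Relation.Unary.Unique.Propositional using (Unique)
  import Data.List.Relation.Unary.Unique.Propositional.Properties as Unique
  open import Data.Nat using (ℕ; zero; suc; _+_; _*_; _^_; _∸_; _≤_; _<_; z≤n; NonZero)
  open import Data.Nat.DivMod using (_/_; m/n*n≤m)
  open import Data.Nat.ListAction using (sum)
  open import Data.Nat.Properties
    using (≤-trans; ≤-reflexive; +-mono-≤; <⇒≢; <⇒≱; +-identityʳ; *-comm; *-distribʳ-+; m∸n+n≡m;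
           module ≤-Reasoning)
  open import Data.Nat.Solver using (module +-*-Solver)
  open import Data.Product using (_×_; _,_; proj₁; proj₂; ∃-syntax)
  open import Data.Sum using (inj₁; inj₂)
  open import Data.Vec as Vec using (Vec; []; _∷_; _++_; here; there)
  open import Data.Vec.Properties using (≡-dec; ∷-injectiveʳ; ++-injective; ++-injectiveʳ; zipWith-++)
  open import Function using (_∘_)
  open import Relation.Binary.PropositionalEquality
  open import Relation.Nullary using (yes; no)

  private
    variable
      k m n r : ℕ

  data Split (k : ℕ) {n : ℕ} : Fin (k + n) → Set where
    left  : (a : Fin k) → Split k (a ↑ˡ n)
    right : (b : Fin n) → Split k (k ↑ʳ b)

  split : ∀ k {n} (x : Fin (k + n)) → Split k x
  split zero    x       = right x
  split (suc k) zero    = left zero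
  split (suc k) (suc x) with split k x
  ... | left a  = left (suc a)
  ... | right b = right b

  split-↑ˡ : ∀ {k n} (a : Fin k) → split k {n} (a ↑ˡ n) ≡ left a
  split-↑ˡ zero = refl
  split-↑ˡ {suc k} {n} (suc a) rewrite split-↑ˡ {k} {n} a = refl

  split-↑ʳ : ∀ k {n} (b : Fin n) → split k (k ↑ʳ b) ≡ right b
  split-↑ʳ zero    b = refl
  split-↑ʳ (suc k) b rewrite split-↑ʳ k b = refl

  ↑ˡ∈++⁺ : ∀ {p : Subset k} (q : Subset n) {a} → a ∈ p → a ↑ˡ n ∈ p ++ q
  ↑ˡ∈++⁺ q here        = here
  ↑ˡ∈++⁺ q (there a∈p) = there (↑ˡ∈++⁺ q a∈p)

  ↑ˡ∈++⁻ : ∀ (p : Subset k) {q : Subset n} {a} → a ↑ˡ n ∈ p ++ q → a ∈ p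
  ↑ˡ∈++⁻ (_ ∷ p) {a = zero}  here       = here
  ↑ˡ∈++⁻ (_ ∷ p) {a = suc a} (there x∈) = there (↑ˡ∈++⁻ p x∈)

  ↑ʳ∈++⁺ : ∀ (p : Subset k) {q : Subset n} {b} → b ∈ q → k ↑ʳ b ∈ p ++ q
  ↑ʳ∈++⁺ []      b∈q = b∈q
  ↑ʳ∈++⁺ (_ ∷ p) b∈q = there (↑ʳ∈++⁺ p b∈q)

  ↑ʳ∈++⁻ : ∀ (p : Subset k) {q : Subset n} {b} → k ↑ʳ b ∈ p ++ q → b ∈ q
  ↑ʳ∈++⁻ []      x∈         = x∈
  ↑ʳ∈++⁻ (_ ∷ p) (there x∈) = ↑ʳ∈++⁻ p x∈

  ∣p++q∣≡∣p∣+∣q∣ : ∀ (p : Subset k) (q : Subset n) → ∣ p ++ q ∣ ≡ ∣ p ∣ + ∣ q ∣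
  ∣p++q∣≡∣p∣+∣q∣ []          q = refl
  ∣p++q∣≡∣p∣+∣q∣ (true ∷ p)  q = cong suc (∣p++q∣≡∣p∣+∣q∣ p q)
  ∣p++q∣≡∣p∣+∣q∣ (false ∷ p) q = ∣p++q∣≡∣p∣+∣q∣ p q

  ∣p++q∩p′++q′∣≤ : ∀ {c d} (p p′ : Subset k) (q q′ : Subset n) →
    ∣ p ∩ p′ ∣ ≤ c → ∣ q ∩ q′ ∣ ≤ d → ∣ (p ++ q) ∩ (p′ ++ q′) ∣ ≤ c + d
  ∣p++q∩p′++q′∣≤ p p′ q q′ ∣p∩p′∣≤c ∣q∩q′∣≤d
    rewrite zipWith-++ Bool._∧_ p q p′ q′ | ∣p++q∣≡∣p∣+∣q∣ (p ∩ p′) (q ∩ q′) =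
    +-mono-≤ ∣p∩p′∣≤c ∣q∩q′∣≤d

  ∣∅∩p∣≤0 : ∀ {n} (p : Subset n) → ∣ ∅ ∩ p ∣ ≤ 0
  ∣∅∩p∣≤0 {n} p = ≤-trans (∣p∩q∣≤∣p∣ ∅ p) (≤-reflexive (∣⊥∣≡0 n))

  ∣p∩∅∣≤0 : ∀ {n} (p : Subset n) → ∣ p ∩ ∅ ∣ ≤ 0
  ∣p∩∅∣≤0 {n} p = ≤-trans (∣p∩q∣≤∣q∣ p ∅) (≤-reflexive (∣⊥∣≡0 n))

  ∈⋃-map-∩⁻ : ∀ (p : Subset n) (qs : List (Subset n)) {x} →
    x ∈ ⋃ (List.map (p ∩_) qs) → ∃[ q ] q ∈ᴸ qs × x ∈ q
  ∈⋃-map-∩⁻ p []       x∈ = ⊥-elim (∉⊥ x∈)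
  ∈⋃-map-∩⁻ p (q ∷ qs) x∈ with x∈p∪q⁻ (p ∩ q) _ x∈
  ... | inj₁ x∈p∩q = q , here refl , proj₂ (x∈p∩q⁻ p q x∈p∩q)
  ... | inj₂ x∈⋃   = let q′ , q′∈ , x∈q′ = ∈⋃-map-∩⁻ p qs x∈⋃ in q′ , there q′∈ , x∈q′

  ⁅⁆-injective : ∀ {i j : Fin n} → ⁅ i ⁆ ≡ ⁅ j ⁆ → i ≡ j
  ⁅⁆-injective {i = i} {j} eq = x∈⁅y⁆⇒x≡y j (subst (i ∈_) eq (x∈⁅x⁆ i))

  -- The blow-up of a hypergraph on Fin m by part sizes s has vertex set Fin (sum s), cut into
  -- consecutive blocks, the u-th of size lookup s u; part s x is the block containing x.
  -- Transversal f s e: e consists of one vertex in the block of each u ∈ f.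
  part : (s : Vec ℕ m) → Fin (Vec.sum s) → Fin m
  part (k ∷ s) x with split k x
  ... | left _  = zero
  ... | right b = suc (part s b)

  part-↑ˡ : ∀ (s : Vec ℕ m) (a : Fin k) → part (k ∷ s) (a ↑ˡ Vec.sum s) ≡ zero
  part-↑ˡ s a rewrite split-↑ˡ {n = Vec.sum s} a = refl

  part-↑ʳ : ∀ k (s : Vec ℕ m) b → part (k ∷ s) (k ↑ʳ b) ≡ suc (part s b)
  part-↑ʳ k s b rewrite split-↑ʳ k b = refl

  data Transversal : (f : Subset m) (s : Vec ℕ m) → Subset (Vec.sum s) → Set where
    []   : Transversal [] [] []
    pick : ∀ {f : Subset m} {s e} (i : Fin k) → Transversal f s e → Transversal (true ∷ f) (k ∷ s) (⁅ i ⁆ ++ e)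
    skip : ∀ {f : Subset m} {s e} → Transversal f s e → Transversal (false ∷ f) (k ∷ s) (∅ ++ e)

  private
    variable
      f f′ : Subset m
      s : Vec ℕ m

  transversal-size : ∀ {e} → Transversal f s e → ∣ e ∣ ≡ ∣ f ∣
  transversal-size []                       = refl
  transversal-size (pick {e = e} i t)       =
    trans (∣p++q∣≡∣p∣+∣q∣ ⁅ i ⁆ e) (cong₂ _+_ (∣⁅x⁆∣≡1 i) (transversal-size t))
  transversal-size (skip {k = k} {e = e} t) =
    trans (∣p++q∣≡∣p∣+∣q∣ (∅ {k}) e) (cong₂ _+_ (∣⊥∣≡0 k) (transversal-size t))

  transversal-∣∩∣≤ : ∀ {e e′} → Transversal f s e → Transversal f′ s e′ →
    ∣ e ∩ e′ ∣ ≤ ∣ f ∩ f′ ∣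
  transversal-∣∩∣≤ [] [] = z≤n
  transversal-∣∩∣≤ (pick {e = e} i t) (pick {e = e′} j t′) =
    ∣p++q∩p′++q′∣≤ ⁅ i ⁆ ⁅ j ⁆ e e′
      (≤-trans (∣p∩q∣≤∣p∣ ⁅ i ⁆ ⁅ j ⁆) (≤-reflexive (∣⁅x⁆∣≡1 i)))
      (transversal-∣∩∣≤ t t′)
  transversal-∣∩∣≤ (pick {e = e} i t) (skip {e = e′} t′) =
    ∣p++q∩p′++q′∣≤ ⁅ i ⁆ ∅ e e′ (∣p∩∅∣≤0 ⁅ i ⁆) (transversal-∣∩∣≤ t t′)
  transversal-∣∩∣≤ (skip {e = e} t) (pick {e = e′} j t′) =
    ∣p++q∩p′++q′∣≤ ∅ ⁅ j ⁆ e e′ (∣∅∩p∣≤0 ⁅ j ⁆) (transversal-∣∩∣≤ t t′)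
  transversal-∣∩∣≤ (skip {k = k} {e = e} t) (skip {e = e′} t′) =
    ∣p++q∩p′++q′∣≤ (∅ {k}) ∅ e e′ (∣∅∩p∣≤0 (∅ {k})) (transversal-∣∩∣≤ t t′)

  transversal-part∈ : ∀ {e} → Transversal f s e → ∀ {x} → x ∈ e → part s x ∈ f
  transversal-part∈ (pick {k = k} i t) {x} x∈ with split k x
  ... | left _  = here
  ... | right b = there (transversal-part∈ t (↑ʳ∈++⁻ ⁅ i ⁆ x∈))
  transversal-part∈ (skip {k = k} t) {x} x∈ with split k x
  ... | left _  = ⊥-elim (∉⊥ (↑ˡ∈++⁻ ∅ x∈))
  ... | right b = there (transversal-part∈ t (↑ʳ∈++⁻ ∅ x∈))

  transversal-part-onto : ∀ {e} → Transversal f s e → ∀ {u} → u ∈ f → ∃[ w ] w ∈ e × part s w ≡ u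
  transversal-part-onto (pick {s = s} {e = e} i t) here =
    i ↑ˡ Vec.sum s , ↑ˡ∈++⁺ e (x∈⁅x⁆ i) , part-↑ˡ s i
  transversal-part-onto (pick {k = k} {s = s} i t) (there u∈f) =
    let w , w∈e , part-w≡u = transversal-part-onto t u∈f
    in  k ↑ʳ w , ↑ʳ∈++⁺ ⁅ i ⁆ w∈e , trans (part-↑ʳ k s w) (cong suc part-w≡u)
  transversal-part-onto (skip {k = k} {s = s} t) (there u∈f) =
    let w , w∈e , part-w≡u = transversal-part-onto t u∈f
    in  k ↑ʳ w , ↑ʳ∈++⁺ ∅ w∈e , trans (part-↑ʳ k s w) (cong suc part-w≡u)

  transversal-part-injective : ∀ {e} → Transversal f s e →
    ∀ {x y} → x ∈ e → y ∈ e → part s x ≡ part s y → x ≡ y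
  transversal-part-injective (pick {k = k} i t) {x} {y} x∈ y∈ eq with split k x | split k y
  ... | left a  | left a′  =
    cong (_↑ˡ _) (trans (x∈⁅y⁆⇒x≡y i (↑ˡ∈++⁻ ⁅ i ⁆ x∈))
                        (sym (x∈⁅y⁆⇒x≡y i (↑ˡ∈++⁻ ⁅ i ⁆ y∈))))
  ... | left _  | right _  = ⊥-elim (0≢1+n eq)
  ... | right _ | left _   = ⊥-elim (0≢1+n (sym eq))
  ... | right b | right b′ =
    cong (k ↑ʳ_) (transversal-part-injective t (↑ʳ∈++⁻ ⁅ i ⁆ x∈) (↑ʳ∈++⁻ ⁅ i ⁆ y∈) (suc-injective eq))
  transversal-part-injective (skip {k = k} t) {x} {y} x∈ y∈ eq with split k x | split k y
  ... | left _  | _        = ⊥-elim (∉⊥ (↑ˡ∈++⁻ ∅ x∈))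
  ... | right _ | left _   = ⊥-elim (∉⊥ (↑ˡ∈++⁻ ∅ y∈))
  ... | right b | right b′ =
    cong (k ↑ʳ_) (transversal-part-injective t (↑ʳ∈++⁻ ∅ x∈) (↑ʳ∈++⁻ ∅ y∈) (suc-injective eq))

  transversal-base-unique : ∀ {e} → Transversal f s e → Transversal f′ s e → f ≡ f′
  transversal-base-unique t t′ = ⊆-antisym (base⊆ t t′) (base⊆ t′ t)
    where
    base⊆ : ∀ {f f′ : Subset m} {e} → Transversal f s e → Transversal f′ s e → f ⊆ f′
    base⊆ t t′ u∈f with transversal-part-onto t u∈f
    ... | w , w∈e , refl = transversal-part∈ t′ w∈e

  edgeWeightℕ : Subset m → Vec ℕ m → ℕ
  edgeWeightℕ []          []      = 1
  edgeWeightℕ (true ∷ f)  (k ∷ s) = k * edgeWeightℕ f s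
  edgeWeightℕ (false ∷ f) (k ∷ s) = edgeWeightℕ f s

  lagPolyℕ : Hypergraph r m → Vec ℕ m → ℕ
  lagPolyℕ H s = sum (List.map (λ f → edgeWeightℕ f s) (edges H))

  transversals : (f : Subset m) (s : Vec ℕ m) → List (Subset (Vec.sum s))
  transversals []          []      = [] ∷ []
  transversals (true ∷ f)  (k ∷ s) = cartesianProductWith _++_ (List.tabulate ⁅_⁆) (transversals f s)
  transversals (false ∷ f) (k ∷ s) = List.map (∅ ++_) (transversals f s)

  ∈-transversals⁻ : ∀ (f : Subset m) s {e} → e ∈ᴸ transversals f s → Transversal f s e
  ∈-transversals⁻ []          []      (here refl) = []
  ∈-transversals⁻ (true ∷ f)  (k ∷ s) e∈
    with ∈-cartesianProductWith⁻ _++_ (List.tabulate ⁅_⁆) (transversals f s) e∈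
  ... | h , e′ , h∈ , e′∈ , refl with ∈-tabulate⁻ h∈
  ...   | i , refl = pick i (∈-transversals⁻ f s e′∈)
  ∈-transversals⁻ (false ∷ f) (k ∷ s) e∈ with ∈-map⁻ (∅ ++_) e∈
  ... | e′ , e′∈ , refl = skip (∈-transversals⁻ f s e′∈)

  transversals-unique : ∀ (f : Subset m) s → Unique (transversals f s)
  transversals-unique []          []      = [] ∷ []
  transversals-unique (true ∷ f)  (k ∷ s) =
    Unique.cartesianProductWith⁺ _++_ (λ {w} {x} → ++-injective w x)
      (Unique.tabulate⁺ ⁅⁆-injective) (transversals-unique f s)
  transversals-unique (false ∷ f) (k ∷ s) =
    Unique.map⁺ (++-injectiveʳ ∅ ∅) (transversals-unique f s)

  length-cartesianProductWith : ∀ {A B C : Set} (g : A → B → C) xs ys →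
    length (cartesianProductWith g xs ys) ≡ length xs * length ys
  length-cartesianProductWith g []       ys = refl
  length-cartesianProductWith g (x ∷ xs) ys =
    trans (length-++ (List.map (g x) ys))
          (cong₂ _+_ (length-map (g x) ys) (length-cartesianProductWith g xs ys))

  length-transversals : ∀ (f : Subset m) s → length (transversals f s) ≡ edgeWeightℕ f s
  length-transversals []          []      = refl
  length-transversals (true ∷ f)  (k ∷ s) =
    trans (length-cartesianProductWith _++_ (List.tabulate {n = k} ⁅_⁆) (transversals f s))
          (cong₂ _*_ (length-tabulate {n = k} ⁅_⁆) (length-transversals f s))
  length-transversals (false ∷ f) (k ∷ s) =
    trans (length-map (∅ ++_) (transversals f s)) (length-transversals f s)

  blowUpEdges : ∀ (fs : List (Subset m)) s → List (Subset (Vec.sum s))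
  blowUpEdges fs s = concatMap (λ f → transversals f s) fs

  ∈-blowUpEdges⁻ : ∀ (fs : List (Subset m)) s {e} → e ∈ᴸ blowUpEdges fs s →
    ∃[ f ] f ∈ᴸ fs × Transversal f s e
  ∈-blowUpEdges⁻ fs s e∈ =
    let f , f∈ , e∈f = find (∈-concatMap⁻ (λ f → transversals f s) e∈)
    in  f , f∈ , ∈-transversals⁻ f s e∈f

  length-blowUpEdges : ∀ (fs : List (Subset m)) s →
    length (blowUpEdges fs s) ≡ sum (List.map (λ f → edgeWeightℕ f s) fs)
  length-blowUpEdges []       s = refl
  length-blowUpEdges (f ∷ fs) s =
    trans (length-++ (transversals f s)) (cong₂ _+_ (length-transversals f s) (length-blowUpEdges fs s))

  blowUp : Hypergraph r m → (s : Vec ℕ m) → Hypergraph r (Vec.sum s)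
  blowUp H s = record
    { edges   = blowUpEdges (edges H) s
    ; uniform = All.tabulate λ e∈ →
        let f , f∈ , t = ∈-blowUpEdges⁻ (edges H) s e∈
        in  trans (transversal-size t) (All.lookup (uniform H) f∈)
    ; simple  = Unique.concat⁺ (All.map⁺ (All.universal (λ f → transversals-unique f s) (edges H)))
                               (AllPairs.map⁺ (AllPairs.map disjoint (simple H)))
    }
    where
    disjoint : ∀ {f f′} → f ≢ f′ → Disjoint (transversals f s) (transversals f′ s)
    disjoint f≢f′ (e∈ , e∈′) =
      f≢f′ (transversal-base-unique (∈-transversals⁻ _ s e∈) (∈-transversals⁻ _ s e∈′))

  numEdges-blowUp : ∀ (H : Hypergraph r m) s → numEdges (blowUp H s) ≡ lagPolyℕ H s
  numEdges-blowUp H = length-blowUpEdges (edges H)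

  addIsolatedVertex : Hypergraph r m → Hypergraph r (suc m)
  addIsolatedVertex H = record
    { edges   = List.map (false ∷_) (edges H)
    ; uniform = All.map⁺ (uniform H)
    ; simple  = Unique.map⁺ ∷-injectiveʳ (simple H)
    }

  lagPolyℕ-addIsolatedVertex : ∀ (H : Hypergraph r m) k s →
    lagPolyℕ (addIsolatedVertex H) (k ∷ s) ≡ lagPolyℕ H s
  lagPolyℕ-addIsolatedVertex H k s = cong sum (sym (map-∘ (edges H)))

  LIntersecting-addIsolatedVertex : ∀ {L} {H : Hypergraph r m} →
    LIntersecting L H → LIntersecting L (addIsolatedVertex H)
  LIntersecting-addIsolatedVertex = AllPairs.map⁺

  edgeWeightℕ-*ʳ : ∀ (f : Subset m) a t → edgeWeightℕ f (Vec.map (_* t) a) ≡ edgeWeightℕ f a * t ^ ∣ f ∣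
  edgeWeightℕ-*ʳ []          []       t = refl
  edgeWeightℕ-*ʳ (true ∷ f)  (a₀ ∷ a) t rewrite edgeWeightℕ-*ʳ f a t =
    solve 4 (λ a t p q → (a :* t) :* (p :* q) := (a :* p) :* (t :* q)) refl a₀ t (edgeWeightℕ f a) (t ^ ∣ f ∣)
    where open +-*-Solver
  edgeWeightℕ-*ʳ (false ∷ f) (a₀ ∷ a) t = edgeWeightℕ-*ʳ f a t

  lagPolyℕ-*ʳ : ∀ (H : Hypergraph r m) a t → lagPolyℕ H (Vec.map (_* t) a) ≡ lagPolyℕ H a * t ^ r
  lagPolyℕ-*ʳ {r} H a t = go (edges H) (uniform H)
    where
    go : ∀ fs → All (λ f → ∣ f ∣ ≡ r) fs →
      sum (List.map (λ f → edgeWeightℕ f (Vec.map (_* t) a)) fs) ≡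
      sum (List.map (λ f → edgeWeightℕ f a) fs) * t ^ r
    go []       []              = refl
    go (f ∷ fs) (∣f∣≡r ∷ ∣fs∣≡r) rewrite edgeWeightℕ-*ʳ f a t | ∣f∣≡r | go fs ∣fs∣≡r =
      sym (*-distribʳ-+ (t ^ r) (edgeWeightℕ f a) _)

  sum-map-*ʳ : ∀ (a : Vec ℕ m) t → Vec.sum (Vec.map (_* t) a) ≡ Vec.sum a * t
  sum-map-*ʳ []       t = refl
  sum-map-*ʳ (a₀ ∷ a) t = trans (cong (a₀ * t +_) (sum-map-*ʳ a t)) (sym (*-distribʳ-+ t a₀ (Vec.sum a)))

  AllPairs-related : ∀ {A : Set} {R : A → A → Set} → (∀ {x y} → R x y → R y x) →
    ∀ {xs x y} → AllPairs R xs → x ∈ᴸ xs → y ∈ᴸ xs → x ≢ y → R x y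
  AllPairs-related sym (_  ∷ _)  (here refl) (here refl) x≢y = ⊥-elim (x≢y refl)
  AllPairs-related sym (Rx ∷ _)  (here refl) (there y∈)  _   = All.lookup Rx y∈
  AllPairs-related sym (Ry ∷ _)  (there x∈)  (here refl) _   = sym (All.lookup Ry x∈)
  AllPairs-related sym (_  ∷ R*) (there x∈)  (there y∈)  x≢y = AllPairs-related sym R* x∈ y∈ x≢y

  tentPartition-shape : ∀ {λs} → TentPartition r k λs →
    ∃[ l ] ∃[ l′ ] ∃[ ls ] λs ≡ l ∷ l′ ∷ ls × k ≤ l × l < r
  tentPartition-shape ((_ , _ , Σλs≡r) , l , []     , refl , _   , l<r) =
    ⊥-elim (<⇒≢ l<r (trans (sym (+-identityʳ l)) Σλs≡r))
  tentPartition-shape (_                , l , l′ ∷ ls , refl , k≤l , l<r) = l , l′ , ls , refl , k≤l , l<r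

  ∩≡⁅v⁆⇒v∈ : ∀ {v : Fin n} {p q qs} → AllPairs (λ a b → a ∩ b ≡ ⁅ v ⁆) (p ∷ q ∷ qs) →
    All (v ∈_) (p ∷ q ∷ qs)
  ∩≡⁅v⁆⇒v∈ {v = v} ((p∩q≡v ∷ p∩qs≡v) ∷ _) =
    proj₁ (v∈both p∩q≡v) ∷ proj₂ (v∈both p∩q≡v) ∷ All.map (proj₂ ∘ v∈both) p∩qs≡v
    where
    v∈both : ∀ {a b} → a ∩ b ≡ ⁅ v ⁆ → v ∈ a × v ∈ b
    v∈both {a} {b} a∩b≡v = x∈p∩q⁻ a b (subst (v ∈_) (sym a∩b≡v) (x∈⁅x⁆ v))

  module _ {L : ℕ → Set} (L<k : ∀ i → L i → i < k) {H : Hypergraph r m} (H-L : LIntersecting L H) where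

    k≤∣∩∣⇒≡ : ∀ {f f′} → f ∈ᴸ edges H → f′ ∈ᴸ edges H → k ≤ ∣ f ∩ f′ ∣ → f ≡ f′
    k≤∣∩∣⇒≡ {f} {f′} f∈ f′∈ k≤∣f∩f′∣ with ≡-dec Bool._≟_ f f′
    ... | yes f≡f′ = f≡f′
    ... | no  f≢f′ =
      ⊥-elim (<⇒≱ (L<k _ (AllPairs-related (λ {a} {b} → L-∩-sym {a} {b}) H-L f∈ f′∈ f≢f′)) k≤∣f∩f′∣)
      where
      L-∩-sym : ∀ {a b : Subset m} → L ∣ a ∩ b ∣ → L ∣ b ∩ a ∣
      L-∩-sym {a} {b} = subst L (cong ∣_∣ (∩-comm a b))

    module _ {𝓕 : List ℕ → Set} (𝓕-tents : ∀ λs → 𝓕 λs → TentPartition r k λs) where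

      LIntersecting⇒Free : Free 𝓕 H
      LIntersecting⇒Free λs λs∈𝓕 tent with tentPartition-shape (𝓕-tents λs λs∈𝓕) | tent
      ... | l , _ , _ , refl , k≤l , l<r | e₀ , e₁ ∷ _ , e₀∈ , e₁∈ ∷ _ , ∣e₀∩e₁∣≡l ∷ _ , _ =
        <⇒≢ l<r (begin
          l            ≡⟨ sym ∣e₀∩e₁∣≡l ⟩
          ∣ e₀ ∩ e₁ ∣  ≡⟨ cong (λ e → ∣ e₀ ∩ e ∣) (sym e₀≡e₁) ⟩
          ∣ e₀ ∩ e₀ ∣  ≡⟨ cong ∣_∣ (∩-idem e₀) ⟩
          ∣ e₀ ∣       ≡⟨ All.lookup (uniform H) e₀∈ ⟩
          r            ∎)
        where
        open ≡-Reasoning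
        e₀≡e₁ : e₀ ≡ e₁
        e₀≡e₁ = k≤∣∩∣⇒≡ e₀∈ e₁∈ (subst (k ≤_) (sym ∣e₀∩e₁∣≡l) k≤l)

      blowUp-Free : ∀ s → Free 𝓕 (blowUp H s)
      blowUp-Free s λs λs∈𝓕 tent with tentPartition-shape (𝓕-tents λs λs∈𝓕) | tent
      ... | l , _ , _ , refl , k≤l , _
          | e₀ , es@(e₁ ∷ e₂ ∷ _) , e₀∈ , es∈@(e₁∈ ∷ _) , ∣e₀∩e₁∣≡l ∷ _ , (e₀∩e₁⊥e₀∩e₂ ∷ _) ∷ _ ,
            cover , v , meets =
        v∉e₀ v∈e₀
        where
        v∈es : All (v ∈_) es
        v∈es = ∩≡⁅v⁆⇒v∈ meets
        v∉e₀ : v ∉ e₀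
        v∉e₀ v∈e₀ = e₀∩e₁⊥e₀∩e₂ (v , x∈p∩q⁺ (x∈p∩q⁺ (v∈e₀ , All.lookup v∈es (here refl)) ,
                                             x∈p∩q⁺ (v∈e₀ , All.lookup v∈es (there (here refl)))))
        v∈e₀ : v ∈ e₀
        v∈e₀ =
          let f₀ , f₀∈ , t₀ = ∈-blowUpEdges⁻ (edges H) s e₀∈
              f₁ , f₁∈ , t₁ = ∈-blowUpEdges⁻ (edges H) s e₁∈
              f₀≡f₁ = k≤∣∩∣⇒≡ f₀∈ f₁∈
                        (≤-trans k≤l (subst (_≤ ∣ f₀ ∩ f₁ ∣) ∣e₀∩e₁∣≡l (transversal-∣∩∣≤ t₀ t₁)))
              part-v∈f₀ = subst (part s v ∈_) (sym f₀≡f₁) (transversal-part∈ t₁ (All.lookup v∈es (here refl)))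
              w , w∈e₀ , part-w≡part-v = transversal-part-onto t₀ part-v∈f₀
              eⱼ , eⱼ∈es , w∈eⱼ = ∈⋃-map-∩⁻ e₀ es (subst (w ∈_) (sym cover) w∈e₀)
              _ , _ , tⱼ = ∈-blowUpEdges⁻ (edges H) s (All.lookup es∈ eⱼ∈es)
          in  subst (_∈ e₀) (transversal-part-injective tⱼ w∈eⱼ (All.lookup v∈es eⱼ∈es) part-w≡part-v) w∈e₀

  IsEx⇒numEdges≤ : ∀ {𝓕 n n′ M} → n′ ≡ n → (G : Hypergraph r n′) → Free 𝓕 G → IsEx r 𝓕 n M →
    numEdges G ≤ M
  IsEx⇒numEdges≤ refl G G-free (_ , maximal) = maximal G G-free

  -- The isolated vertex is blown up into the n ∸ sum s vertices that s leaves unused.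
  IsEx⇒lagPolyℕ≤ : ∀ {L 𝓕} → (∀ i → L i → i < k) → (∀ λs → 𝓕 λs → TentPartition r k λs) →
    ∀ {H : Hypergraph r m} → LIntersecting L H →
    ∀ s {n M} → Vec.sum s ≤ n → IsEx r 𝓕 n M → lagPolyℕ H s ≤ M
  IsEx⇒lagPolyℕ≤ {r = r} {m = m} {L = L} {𝓕 = 𝓕} L<k 𝓕-tents {H} H-L s {n} {M} Σs≤n isEx = begin
    lagPolyℕ H s                  ≡⟨ lagPolyℕ-addIsolatedVertex H d s ⟨
    lagPolyℕ H⁺ (d ∷ s)           ≡⟨ numEdges-blowUp H⁺ (d ∷ s) ⟨
    numEdges (blowUp H⁺ (d ∷ s))  ≤⟨ IsEx⇒numEdges≤ (m∸n+n≡m Σs≤n) (blowUp H⁺ (d ∷ s)) G-free isEx ⟩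
    M                             ∎
    where
    open ≤-Reasoning
    H⁺ : Hypergraph r (suc m)
    H⁺ = addIsolatedVertex H
    d : ℕ
    d = n ∸ Vec.sum s
    G-free : Free 𝓕 (blowUp H⁺ (d ∷ s))
    G-free = blowUp-Free L<k {H = H⁺} (LIntersecting-addIsolatedVertex {L = L} {H = H} H-L) 𝓕-tents (d ∷ s)

  IsEx⇒lagPolyℕ*⌊n/D⌋^r≤ : ∀ {L 𝓕} → (∀ i → L i → i < k) →
    (∀ λs → 𝓕 λs → TentPartition r k λs) → ∀ {H : Hypergraph r m} → LIntersecting L H → ∀ a {D} .{{_ : NonZero D}} → Vec.sum a ≡ D →
    ∀ n {M} → IsEx r 𝓕 n M → lagPolyℕ H a * (n / D) ^ r ≤ M
  IsEx⇒lagPolyℕ*⌊n/D⌋^r≤ L<k 𝓕-tents {H} H-L a {D} Σa≡D n {M} isEx =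
    subst (_≤ M) (lagPolyℕ-*ʳ H a t) (IsEx⇒lagPolyℕ≤ L<k 𝓕-tents {H = H} H-L (Vec.map (_* t) a) Σat≤n isEx)
    where
    t : ℕ
    t = n / D
    Σat≤n : Vec.sum (Vec.map (_* t) a) ≤ n
    Σat≤n = subst (_≤ n) (sym (trans (sum-map-*ʳ a t) (trans (cong (_* t) Σa≡D) (*-comm D t)))) (m/n*n≤m n D)

module FloorBound where
  open import Data.Bool using (true)
  open import Data.Nat using (ℕ; zero; suc; _+_; _*_; _∸_; _^_; _!; _≤_; NonZero; _≤ᵇ_)
  open import Data.Nat.Properties
  open import Data.Nat.Combinatorics using (_C_; nCk≡nPk/k!)
  open import Data.Nat.Combinatorics.Base using (_P′_; _P_)
  open import Data.Nat.Combinatorics.Specification using (k!∣nP′k)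
  open import Data.Nat.DivMod using (_/_; _%_; m/n*n≡m; m≡m%n+[m/n]*n; m%n<n; m/n*n≤m)
  open import Data.Nat.Solver using (module +-*-Solver)
  open import Data.Product using (_,_; ∃-syntax)
  open import Relation.Binary.PropositionalEquality
  open +-*-Solver

  nCk*k!≡nP′k : ∀ {n k} → k ≤ n → (n C k) * k ! ≡ n P′ k
  nCk*k!≡nP′k {n} {k} k≤n = begin
    (n C k) * k !                      ≡⟨ cong (_* k !) (nCk≡nPk/k! k≤n) ⟩
    ((n P k) / k !) {{k !≢0}} * k !    ≡⟨ cong (λ x → (x / k !) {{k !≢0}} * k !) nPk≡nP′k ⟩
    ((n P′ k) / k !) {{k !≢0}} * k !   ≡⟨ m/n*n≡m {{k !≢0}} (k!∣nP′k k≤n) ⟩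
    n P′ k                             ∎
    where
    open ≡-Reasoning
    nPk≡nP′k : n P k ≡ n P′ k
    nPk≡nP′k with k ≤ᵇ n | ≤⇒≤ᵇ k≤n
    ... | true | _ = refl

  nP′k≤n^k : ∀ n k → n P′ k ≤ n ^ k
  nP′k≤n^k n zero    = ≤-refl
  nP′k≤n^k n (suc k) = *-mono-≤ (m∸n≤m n k) (nP′k≤n^k n k)

  n^k≤2^k*nP′k : ∀ n k → 2 * k ≤ n → n ^ k ≤ 2 ^ k * (n P′ k)
  n^k≤2^k*nP′k n zero    _      = ≤-refl
  n^k≤2^k*nP′k n (suc k) 2k+2≤n = begin
    n * n ^ k                         ≤⟨ *-mono-≤ n≤2[n∸k] (n^k≤2^k*nP′k n k 2k≤n) ⟩
    2 * (n ∸ k) * (2 ^ k * (n P′ k))  ≡⟨ solve 3 (λ d a p → con 2 :* d :* (a :* p) := con 2 :* a :* (d :* p))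
                                               refl (n ∸ k) (2 ^ k) (n P′ k) ⟩
    2 * 2 ^ k * ((n ∸ k) * (n P′ k))  ∎
    where
    open ≤-Reasoning
    2k≤n : 2 * k ≤ n
    2k≤n = ≤-trans (*-monoʳ-≤ 2 (n≤1+n k)) 2k+2≤n
    n≤2[n∸k] : n ≤ 2 * (n ∸ k)
    n≤2[n∸k] = begin
      n                  ≤⟨ m+n≤o⇒m≤o∸n n (+-monoʳ-≤ n 2k≤n) ⟩
      n + n ∸ 2 * k      ≡⟨ cong (_∸ 2 * k) (solve 1 (λ n → n :+ n := con 2 :* n) refl n) ⟩
      2 * n ∸ 2 * k      ≡⟨ *-distribˡ-∸ 2 n k ⟨
      2 * (n ∸ k)        ∎

  [m*n]^k≡m^k*n^k : ∀ m n k → (m * n) ^ k ≡ m ^ k * n ^ k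
  [m*n]^k≡m^k*n^k m n zero    = refl
  [m*n]^k≡m^k*n^k m n (suc k) = trans (cong (m * n *_) ([m*n]^k≡m^k*n^k m n k))
    (solve 4 (λ m n x y → (m :* n) :* (x :* y) := (m :* x) :* (n :* y)) refl m n (m ^ k) (n ^ k))

  [x+d]^[1+k]≤ : ∀ x d k → (x + d) ^ suc k ≤ x ^ suc k + suc k * d * (x + d) ^ k
  [x+d]^[1+k]≤ x d zero    =
    ≤-reflexive (solve 2 (λ x d → (x :+ d) :* con 1 := x :* con 1 :+ con 1 :* d :* con 1) refl x d)
  [x+d]^[1+k]≤ x d (suc k) = begin
    (x + d) * (x + d) ^ suc k
      ≤⟨ *-monoʳ-≤ (x + d) ([x+d]^[1+k]≤ x d k) ⟩
    (x + d) * (x ^ suc k + suc k * d * (x + d) ^ k)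
      ≡⟨ solve 5 (λ x d r a b → (x :+ d) :* (a :+ r :* d :* b) := x :* a :+ d :* a :+ r :* d :* ((x :+ d) :* b))
               refl x d (suc k) (x ^ suc k) ((x + d) ^ k) ⟩
    x * x ^ suc k + d * x ^ suc k + suc k * d * (x + d) ^ suc k
      ≤⟨ +-monoˡ-≤ _ (+-monoʳ-≤ (x * x ^ suc k) (*-monoʳ-≤ d (^-monoˡ-≤ (suc k) (m≤m+n x d)))) ⟩
    x * x ^ suc k + d * (x + d) ^ suc k + suc k * d * (x + d) ^ suc k
      ≡⟨ solve 4 (λ a d r b → a :+ d :* b :+ r :* d :* b := a :+ (con 1 :+ r) :* d :* b)
               refl (x * x ^ suc k) d (suc k) ((x + d) ^ suc k) ⟩
    x ^ suc (suc k) + suc (suc k) * d * (x + d) ^ suc k ∎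
    where open ≤-Reasoning

  n≤n/d*d+d : ∀ n d .{{_ : NonZero d}} → n ≤ n / d * d + d
  n≤n/d*d+d n d = begin
    n                  ≡⟨ m≡m%n+[m/n]*n n d ⟩
    n % d + n / d * d  ≤⟨ +-monoˡ-≤ (n / d * d) (<⇒≤ (m%n<n n d)) ⟩
    d + n / d * d      ≡⟨ +-comm d (n / d * d) ⟩
    n / d * d + d      ∎
    where open ≤-Reasoning

  B*n^k≤nC[1+k] : ∀ B k n → B * 2 ^ suc k * suc k ! ≤ n → 2 * suc k ≤ n → B * n ^ k ≤ n C suc k
  B*n^k≤nC[1+k] B k n B*2^r*r!≤n 2r≤n = *-cancelʳ-≤ _ _ (2 ^ r * r !) {{m*n≢0 _ _ {{m^n≢0 2 r}} {{r !≢0}}}} (begin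
    B * n ^ k * (2 ^ r * r !)  ≡⟨ solve 4 (λ B a c f → B :* a :* (c :* f) := B :* c :* f :* a) refl B (n ^ k) (2 ^ r) (r !) ⟩
    B * 2 ^ r * r ! * n ^ k    ≤⟨ *-monoˡ-≤ (n ^ k) B*2^r*r!≤n ⟩
    n ^ r                      ≤⟨ n^k≤2^k*nP′k n r 2r≤n ⟩
    2 ^ r * (n P′ r)           ≡⟨ cong (2 ^ r *_) (nCk*k!≡nP′k (≤-trans (m≤n*m r 2) 2r≤n)) ⟨
    2 ^ r * ((n C r) * r !)    ≡⟨ solve 3 (λ c C f → c :* (C :* f) := C :* (c :* f)) refl (2 ^ r) (n C r) (r !) ⟩
    (n C r) * (2 ^ r * r !)    ∎)
    where
    open ≤-Reasoning
    r : ℕ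
    r = suc k

  -- r!·C(n, r) ≤ n^r ≤ (D⌊n/D⌋ + D)^r, whose excess over (D⌊n/D⌋)^r is at most r·D·(2n)^(r−1);
  -- N is chosen so that B*n^k≤nC[1+k] absorbs A times this excess into C(n, r).
  floor-power-bound : ∀ r A D .{{_ : NonZero D}} → ∃[ N ] ∀ n → N ≤ n →
    r ! * A * (n C r) ≤ A * D ^ r * (n / D) ^ r + D ^ r * (n C r)
  floor-power-bound zero       A D = 0 , λ n _ →
    ≤-trans (≤-reflexive (solve 1 (λ A → con 1 :* A :* con 1 := A :* con 1 :* con 1) refl A)) (m≤m+n _ 1)
  floor-power-bound r@(suc r′) A D = B * 2 ^ r * r ! + 2 * r + D , bound
    where
    B : ℕ
    B = A * r * D * 2 ^ r′
    bound : ∀ n → B * 2 ^ r * r ! + 2 * r + D ≤ n →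
      r ! * A * (n C r) ≤ A * D ^ r * (n / D) ^ r + D ^ r * (n C r)
    bound n N≤n = begin
      r ! * A * (n C r)                                ≡⟨ solve 3 (λ f A c → f :* A :* c := A :* (c :* f)) refl (r !) A (n C r) ⟩
      A * ((n C r) * r !)                              ≡⟨ cong (A *_) (nCk*k!≡nP′k (≤-trans (m≤n*m r 2) 2r≤n)) ⟩
      A * (n P′ r)                                     ≤⟨ *-monoʳ-≤ A (nP′k≤n^k n r) ⟩
      A * n ^ r                                        ≤⟨ *-monoʳ-≤ A (^-monoˡ-≤ r (n≤n/d*d+d n D)) ⟩
      A * (t * D + D) ^ r                              ≤⟨ *-monoʳ-≤ A ([x+d]^[1+k]≤ (t * D) D r′) ⟩
      A * ((t * D) ^ r + r * D * (t * D + D) ^ r′)     ≤⟨ *-monoʳ-≤ A (+-monoʳ-≤ _ (*-monoʳ-≤ (r * D) (^-monoˡ-≤ r′ tD+D≤2n))) ⟩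
      A * ((t * D) ^ r + r * D * (2 * n) ^ r′)         ≡⟨ cong₂ (λ a b → A * (a + r * D * b)) ([m*n]^k≡m^k*n^k t D r)
                                                                                               ([m*n]^k≡m^k*n^k 2 n r′) ⟩
      A * (t ^ r * D ^ r + r * D * (2 ^ r′ * n ^ r′))  ≡⟨ solve 7 (λ A T Dr r D a b →
                                                                  A :* (T :* Dr :+ r :* D :* (a :* b)) := A :* Dr :* T :+ A :* r :* D :* a :* b)
                                                                refl A (t ^ r) (D ^ r) r D (2 ^ r′) (n ^ r′) ⟩
      A * D ^ r * t ^ r + B * n ^ r′                   ≤⟨ +-monoʳ-≤ (A * D ^ r * t ^ r) (B*n^k≤nC[1+k] B r′ n B*2^r*r!≤n 2r≤n) ⟩
      A * D ^ r * t ^ r + n C r                        ≤⟨ +-monoʳ-≤ (A * D ^ r * t ^ r) (m≤n*m (n C r) (D ^ r) {{m^n≢0 D r}}) ⟩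
      A * D ^ r * t ^ r + D ^ r * (n C r)              ∎
      where
      open ≤-Reasoning
      t : ℕ
      t = n / D
      B*2^r*r!≤n : B * 2 ^ r * r ! ≤ n
      B*2^r*r!≤n = ≤-trans (≤-trans (m≤m+n _ (2 * r)) (m≤m+n _ D)) N≤n
      2r≤n : 2 * r ≤ n
      2r≤n = ≤-trans (≤-trans (m≤n+m (2 * r) _) (m≤m+n _ D)) N≤n
      tD+D≤2n : t * D + D ≤ 2 * n
      tD+D≤2n = ≤-trans (+-mono-≤ (m/n*n≤m n D) (≤-trans (m≤n+m D _) N≤n))
                        (≤-reflexive (solve 1 (λ n → n :+ n := con 2 :* n) refl n))

module ClearingDenominators where
  open BlowUp using (edgeWeightℕ; lagPolyℕ)
  open import Data.Bool using (true; false; if_then_else_)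
  open import Data.Fin using (Fin; zero; suc)
  open import Data.Fin.Subset using (∣_∣)
  open import Data.Integer as ℤ using (+_; -[1+_])
  import Data.Integer.Properties as ℤ
  open import Data.List as List using ([]; _∷_)
  open import Data.List.Properties using (map-∘)
  open import Data.List.Relation.Unary.All using (All; []; _∷_)
  open import Data.Nat as ℕ using (ℕ; zero; suc; NonZero)
  import Data.Nat.Properties as ℕ
  open import Data.Nat.ListAction using (sum)
  open import Data.Nat.Coprimality using (1-coprimeTo) renaming (sym to coprime-sym)
  open import Data.Product using (_×_; _,_; ∃-syntax)
  open import Data.Rational using (ℚ; mkℚ; _/_; 0ℚ; 1ℚ; ↥_; ↧ₙ_; _+_; _*_; _-_; -_; _≤_; _<_; *≤*; *<*; Positive)
  import Data.Rational.Properties as ℚ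
  open import Data.Rational.Solver using (module +-*-Solver)
  import Data.Rational.Unnormalised as ℚᵘ
  import Data.Rational.Unnormalised.Properties as ℚᵘ
  open import Data.Vec as Vec using (Vec; []; _∷_; toList; allFin; lookup)
  open import Data.Vec.Properties using (allFin-map; toList-map; lookup-map)
  open import Function using (_∘_)
  open import Relation.Binary.PropositionalEquality

  ℕ→ℚ≡mkℚ : ∀ m → ℕ→ℚ m ≡ mkℚ (+ m) 0 (coprime-sym (1-coprimeTo m))
  ℕ→ℚ≡mkℚ m = ℚ.normalize-coprime (coprime-sym (1-coprimeTo m))

  ℕ→ℚ-+ : ∀ a b → ℕ→ℚ (a ℕ.+ b) ≡ ℕ→ℚ a + ℕ→ℚ b
  ℕ→ℚ-+ a b rewrite ℕ→ℚ≡mkℚ a | ℕ→ℚ≡mkℚ b =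
    cong (_/ 1) (trans (ℤ.pos-+ a b) (sym (cong₂ ℤ._+_ (ℤ.*-identityʳ (+ a)) (ℤ.*-identityʳ (+ b)))))

  ℕ→ℚ-* : ∀ a b → ℕ→ℚ (a ℕ.* b) ≡ ℕ→ℚ a * ℕ→ℚ b
  ℕ→ℚ-* a b rewrite ℕ→ℚ≡mkℚ a | ℕ→ℚ≡mkℚ b = cong (_/ 1) (ℤ.pos-* a b)

  ℕ→ℚ-mono : ∀ {a b} → a ℕ.≤ b → ℕ→ℚ a ≤ ℕ→ℚ b
  ℕ→ℚ-mono {a} {b} a≤b rewrite ℕ→ℚ≡mkℚ a | ℕ→ℚ≡mkℚ b =
    *≤* (subst₂ ℤ._≤_ (sym (ℤ.*-identityʳ (+ a))) (sym (ℤ.*-identityʳ (+ b))) (ℤ.+≤+ a≤b))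

  ℕ→ℚ-injective : ∀ {a b} → ℕ→ℚ a ≡ ℕ→ℚ b → a ≡ b
  ℕ→ℚ-injective {a} {b} eq rewrite ℕ→ℚ≡mkℚ a | ℕ→ℚ≡mkℚ b = ℤ.+-injective (cong ↥_ eq)

  ℕ→ℚ-positive : ∀ n .{{_ : NonZero n}} → Positive (ℕ→ℚ n)
  ℕ→ℚ-positive (suc n) rewrite ℕ→ℚ≡mkℚ (suc n) = _

  nonNegative⇒↥≡+ : ∀ {q} → 0ℚ ≤ q → ∃[ a ] ↥ q ≡ + a
  nonNegative⇒↥≡+ {mkℚ (+ a)    _ _} _        = a , refl
  nonNegative⇒↥≡+ {mkℚ -[1+ _ ] _ _} (*≤* ())

  positive⇒↥≡1+ : ∀ {q} → 0ℚ < q → ∃[ a ] ↥ q ≡ + suc a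
  positive⇒↥≡1+ {mkℚ ℤ.+[1+ a ] _ _} _               = a , refl
  positive⇒↥≡1+ {mkℚ (+ 0)      _ _} (*<* (ℤ.+<+ ()))
  positive⇒↥≡1+ {mkℚ -[1+ _ ]   _ _} (*<* ())

  *-↧ₙ≡↥ : ∀ (q : ℚ) {a} → ↥ q ≡ + a → q * ℕ→ℚ (↧ₙ q) ≡ ℕ→ℚ a
  *-↧ₙ≡↥ q@(mkℚ _ d-1 _) {a} refl rewrite ℕ→ℚ≡mkℚ (suc d-1) | ℕ→ℚ≡mkℚ a =
    ℚ.toℚᵘ-injective (ℚᵘ.≃-trans (ℚ.toℚᵘ-homo-* q (mkℚ (+ suc d-1) 0 (coprime-sym (1-coprimeTo (suc d-1)))))
      (ℚᵘ.*≡* (trans (ℤ.*-identityʳ (+ a ℤ.* + suc d-1))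
                     (cong (λ d → + a ℤ.* + d) (sym (ℕ.*-identityʳ (suc d-1)))))))

  ≤-fromScaled : ∀ (c ε : ℚ) (P X Y C M : ℕ) .{{_ : NonZero P}} →
    c * ℕ→ℚ P ≡ ℕ→ℚ X → ε * ℕ→ℚ P ≡ ℕ→ℚ Y → X ℕ.* C ℕ.≤ P ℕ.* M ℕ.+ Y ℕ.* C →
    (c - ε) * ℕ→ℚ C ≤ ℕ→ℚ M
  ≤-fromScaled c ε P X Y C M c*P≡X ε*P≡Y X*C≤P*M+Y*C = ℚ.*-cancelʳ-≤-pos (ℕ→ℚ P) {{ℕ→ℚ-positive P}} (begin
    (c - ε) * ℕ→ℚ C * ℕ→ℚ P                        ≡⟨ solve 4 (λ c ε C P → (c :- ε) :* C :* P := c :* P :* C :- ε :* P :* C)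
                                                               refl c ε (ℕ→ℚ C) (ℕ→ℚ P) ⟩
    c * ℕ→ℚ P * ℕ→ℚ C - ε * ℕ→ℚ P * ℕ→ℚ C          ≡⟨ cong₂ (λ x y → x * ℕ→ℚ C - y * ℕ→ℚ C) c*P≡X ε*P≡Y ⟩
    ℕ→ℚ X * ℕ→ℚ C - ℕ→ℚ Y * ℕ→ℚ C                  ≡⟨ cong₂ _-_ (ℕ→ℚ-* X C) (ℕ→ℚ-* Y C) ⟨
    ℕ→ℚ (X ℕ.* C) - ℕ→ℚ (Y ℕ.* C)                  ≤⟨ ℚ.+-monoˡ-≤ (- ℕ→ℚ (Y ℕ.* C)) (ℕ→ℚ-mono X*C≤P*M+Y*C) ⟩
    ℕ→ℚ (P ℕ.* M ℕ.+ Y ℕ.* C) - ℕ→ℚ (Y ℕ.* C)      ≡⟨ cong (_- ℕ→ℚ (Y ℕ.* C)) (ℕ→ℚ-+ (P ℕ.* M) (Y ℕ.* C)) ⟩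
    ℕ→ℚ (P ℕ.* M) + ℕ→ℚ (Y ℕ.* C) - ℕ→ℚ (Y ℕ.* C)  ≡⟨ solve 2 (λ a b → a :+ b :- b := a) refl (ℕ→ℚ (P ℕ.* M)) (ℕ→ℚ (Y ℕ.* C)) ⟩
    ℕ→ℚ (P ℕ.* M)                                  ≡⟨ trans (ℕ→ℚ-* P M) (ℚ.*-comm (ℕ→ℚ P) (ℕ→ℚ M)) ⟩
    ℕ→ℚ M * ℕ→ℚ P                                  ∎)
    where
    open ℚ.≤-Reasoning
    open +-*-Solver

  foldr-map-allFin-suc : ∀ {A : Set} {n} (_∙_ : A → A → A) (ε : A) (g : Fin (suc n) → A) →
    List.foldr _∙_ ε (List.map g (toList (allFin (suc n)))) ≡
    g zero ∙ List.foldr _∙_ ε (List.map (g ∘ suc) (toList (allFin n)))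
  foldr-map-allFin-suc {n = n} _∙_ ε g =
    trans (cong (λ xs → List.foldr _∙_ ε (List.map g xs))
                (trans (cong toList (allFin-map n)) (cong (zero ∷_) (toList-map suc (allFin n)))))
          (cong (λ xs → g zero ∙ List.foldr _∙_ ε xs) (sym (map-∘ (toList (allFin n)))))

  edgeWeight-∷ : ∀ {m} (y : Fin (suc m) → ℚ) b e →
    edgeWeight y (b ∷ e) ≡ (if b then y zero else 1ℚ) * edgeWeight (y ∘ suc) e
  edgeWeight-∷ y b e = foldr-map-allFin-suc _*_ 1ℚ (λ u → if lookup (b ∷ e) u then y u else 1ℚ)

  Scales : ∀ {m} → (Fin m → ℚ) → ℕ → Vec ℕ m → Set
  Scales y D a = ∀ u → ℕ→ℚ (lookup a u) ≡ y u * ℕ→ℚ D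

  commonDenominator : ∀ {m} (y : Fin m → ℚ) → (∀ u → 0ℚ ≤ y u) → ∃[ D ] NonZero D × ∃[ a ] Scales y D a
  commonDenominator {zero}  y _   = 1 , _ , [] , λ ()
  commonDenominator {suc m} y y≥0 =
    let p , ↥y₀≡p          = nonNegative⇒↥≡+ (y≥0 zero)
        D , D≢0 , a , a≡yD = commonDenominator (y ∘ suc) (y≥0 ∘ suc)
        q = ↧ₙ y zero
        scales : Scales y (q ℕ.* D) (p ℕ.* D ∷ Vec.map (ℕ._* q) a)
        scales = λ where
          zero → begin
            ℕ→ℚ (p ℕ.* D)                  ≡⟨ ℕ→ℚ-* p D ⟩
            ℕ→ℚ p * ℕ→ℚ D                  ≡⟨ cong (_* ℕ→ℚ D) (*-↧ₙ≡↥ (y zero) ↥y₀≡p) ⟨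
            y zero * ℕ→ℚ q * ℕ→ℚ D         ≡⟨ ℚ.*-assoc (y zero) (ℕ→ℚ q) (ℕ→ℚ D) ⟩
            y zero * (ℕ→ℚ q * ℕ→ℚ D)       ≡⟨ cong (y zero *_) (ℕ→ℚ-* q D) ⟨
            y zero * ℕ→ℚ (q ℕ.* D)         ∎
          (suc u) → begin
            ℕ→ℚ (lookup (Vec.map (ℕ._* q) a) u)  ≡⟨ cong ℕ→ℚ (lookup-map u (ℕ._* q) a) ⟩
            ℕ→ℚ (lookup a u ℕ.* q)               ≡⟨ ℕ→ℚ-* (lookup a u) q ⟩
            ℕ→ℚ (lookup a u) * ℕ→ℚ q             ≡⟨ cong (_* ℕ→ℚ q) (a≡yD u) ⟩
            y (suc u) * ℕ→ℚ D * ℕ→ℚ q            ≡⟨ solve 3 (λ y D q → y :* D :* q := y :* (q :* D))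
                                                             refl (y (suc u)) (ℕ→ℚ D) (ℕ→ℚ q) ⟩
            y (suc u) * (ℕ→ℚ q * ℕ→ℚ D)          ≡⟨ cong (y (suc u) *_) (ℕ→ℚ-* q D) ⟨
            y (suc u) * ℕ→ℚ (q ℕ.* D)            ∎
    in  q ℕ.* D , ℕ.m*n≢0 q D {{_}} {{D≢0}} , p ℕ.* D ∷ Vec.map (ℕ._* q) a , scales
    where
    open ≡-Reasoning
    open +-*-Solver

  edgeWeight-scaled : ∀ {m} {y : Fin m → ℚ} D a → Scales y D a → ∀ e →
    edgeWeight y e * ℕ→ℚ (D ℕ.^ ∣ e ∣) ≡ ℕ→ℚ (edgeWeightℕ e a)
  edgeWeight-scaled D []       scales []          = ℚ.*-identityˡ 1ℚ
  edgeWeight-scaled {y = y} D (a₀ ∷ a) scales (true ∷ e) = begin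
    edgeWeight y (true ∷ e) * ℕ→ℚ (D ℕ.* D ℕ.^ ∣ e ∣)  ≡⟨ cong₂ _*_ (edgeWeight-∷ y true e) (ℕ→ℚ-* D (D ℕ.^ ∣ e ∣)) ⟩
    y zero * W * (ℕ→ℚ D * ℕ→ℚ (D ℕ.^ ∣ e ∣))           ≡⟨ solve 4 (λ y w d p → (y :* w) :* (d :* p) := (y :* d) :* (w :* p))
                                                                refl (y zero) W (ℕ→ℚ D) (ℕ→ℚ (D ℕ.^ ∣ e ∣)) ⟩
    y zero * ℕ→ℚ D * (W * ℕ→ℚ (D ℕ.^ ∣ e ∣))           ≡⟨ cong₂ _*_ (scales zero)
                                                                (sym (edgeWeight-scaled {y = y ∘ suc} D a (scales ∘ suc) e)) ⟨
    ℕ→ℚ a₀ * ℕ→ℚ (edgeWeightℕ e a)                     ≡⟨ ℕ→ℚ-* a₀ (edgeWeightℕ e a) ⟨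
    ℕ→ℚ (a₀ ℕ.* edgeWeightℕ e a)                       ∎
    where
    open ≡-Reasoning
    open +-*-Solver
    W : ℚ
    W = edgeWeight (y ∘ suc) e
  edgeWeight-scaled {y = y} D (a₀ ∷ a) scales (false ∷ e) = begin
    edgeWeight y (false ∷ e) * ℕ→ℚ (D ℕ.^ ∣ e ∣)      ≡⟨ cong (_* ℕ→ℚ (D ℕ.^ ∣ e ∣)) (edgeWeight-∷ y false e) ⟩
    1ℚ * edgeWeight (y ∘ suc) e * ℕ→ℚ (D ℕ.^ ∣ e ∣)  ≡⟨ cong (_* ℕ→ℚ (D ℕ.^ ∣ e ∣)) (ℚ.*-identityˡ (edgeWeight (y ∘ suc) e)) ⟩
    edgeWeight (y ∘ suc) e * ℕ→ℚ (D ℕ.^ ∣ e ∣)       ≡⟨ edgeWeight-scaled {y = y ∘ suc} D a (scales ∘ suc) e ⟩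
    ℕ→ℚ (edgeWeightℕ e a)                            ∎
    where open ≡-Reasoning

  lagPoly-scaled : ∀ {r m} (H : Hypergraph r m) {y} D a → Scales y D a →
    lagPoly H y * ℕ→ℚ (D ℕ.^ r) ≡ ℕ→ℚ (lagPolyℕ H a)
  lagPoly-scaled {r} H {y} D a scales = go (edges H) (uniform H)
    where
    edge-scaled : ∀ {e} → ∣ e ∣ ≡ r → edgeWeight y e * ℕ→ℚ (D ℕ.^ r) ≡ ℕ→ℚ (edgeWeightℕ e a)
    edge-scaled {e} refl = edgeWeight-scaled D a scales e
    go : ∀ es → All (λ e → ∣ e ∣ ≡ r) es →
      List.foldr _+_ 0ℚ (List.map (edgeWeight y) es) * ℕ→ℚ (D ℕ.^ r) ≡
      ℕ→ℚ (sum (List.map (λ e → edgeWeightℕ e a) es))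
    go []       []              = ℚ.*-zeroˡ (ℕ→ℚ (D ℕ.^ r))
    go (e ∷ es) (∣e∣≡r ∷ ∣es∣≡r) = trans (ℚ.*-distribʳ-+ (ℕ→ℚ (D ℕ.^ r)) (edgeWeight y e) _)
      (trans (cong₂ _+_ (edge-scaled {e} ∣e∣≡r) (go es ∣es∣≡r)) (sym (ℕ→ℚ-+ (edgeWeightℕ e a) _)))

  simplexSum-scaled : ∀ {m} {y : Fin m → ℚ} D a → Scales y D a →
    List.foldr _+_ 0ℚ (List.map y (toList (allFin m))) * ℕ→ℚ D ≡ ℕ→ℚ (Vec.sum a)
  simplexSum-scaled D []       scales = ℚ.*-zeroˡ (ℕ→ℚ D)
  simplexSum-scaled {y = y} D (a₀ ∷ a) scales = begin
    List.foldr _+_ 0ℚ (List.map y (toList (allFin _))) * ℕ→ℚ D  ≡⟨ cong (_* ℕ→ℚ D) (foldr-map-allFin-suc _+_ 0ℚ y) ⟩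
    (y zero + S) * ℕ→ℚ D                                         ≡⟨ ℚ.*-distribʳ-+ (ℕ→ℚ D) (y zero) S ⟩
    y zero * ℕ→ℚ D + S * ℕ→ℚ D                                   ≡⟨ cong₂ _+_ (scales zero)
                                                                         (sym (simplexSum-scaled {y = y ∘ suc} D a (scales ∘ suc))) ⟨
    ℕ→ℚ a₀ + ℕ→ℚ (Vec.sum a)                                     ≡⟨ ℕ→ℚ-+ a₀ (Vec.sum a) ⟨
    ℕ→ℚ (a₀ ℕ.+ Vec.sum a)                                       ∎
    where
    open ≡-Reasoning
    S : ℚ
    S = List.foldr _+_ 0ℚ (List.map (y ∘ suc) (toList (allFin _)))

open import Data.List using (List)
open import Data.Nat using (ℕ; suc; _+_; _*_; _^_; _!; _≤_; _<_; NonZero)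
open import Data.Nat.Combinatorics using (_C_)
open import Data.Nat.DivMod using (_/_)
open import Data.Nat.Properties
  using (+-mono-≤; *-monoʳ-≤; m≤n*m; *-assoc; m*n≢0; m^n≢0; module ≤-Reasoning)
open import Data.Nat.Solver using (module +-*-Solver)
open import Data.Product using (_×_; _,_)
open import Data.Rational as ℚ using (ℚ; ↧ₙ_)
import Data.Rational.Properties as ℚ
open import Data.Rational.Solver renaming (module +-*-Solver to ℚ-Solver)
import Data.Vec as Vec
open import Relation.Binary.PropositionalEquality
open BlowUp using (lagPolyℕ; LIntersecting⇒Free; IsEx⇒lagPolyℕ*⌊n/D⌋^r≤)
open FloorBound using (floor-power-bound)
open ClearingDenominators

-- ε ≥ 1/E for E = ↧ₙ ε, so after multiplying by P = D^r·E every quantity is a natural number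
-- and the claim follows from floor-power-bound for A = Q·E.
ex≥Q⌊n/D⌋^r⇒≤π : ∀ {r 𝓕} (c : ℚ) (Q D : ℕ) .{{_ : NonZero D}} →
  c ℚ.* ℕ→ℚ (D ^ r) ≡ ℕ→ℚ (r ! * Q) →
  (∀ n M → IsEx r 𝓕 n M → Q * (n / D) ^ r ≤ M) → ≤π r 𝓕 c
ex≥Q⌊n/D⌋^r⇒≤π {r} c Q D c*D^r≡r!*Q ex≥ ε ε>0 with positive⇒↥≡1+ ε>0 | floor-power-bound r (Q * ↧ₙ ε) D
... | e , ↥ε≡1+e | N , bound = N , λ n M N≤n isEx →
  ≤-fromScaled c ε P X Y (n C r) M {{P≢0}} c*P≡X ε*P≡Y (X*C≤P*M+Y*C (bound n N≤n) (ex≥ n M isEx))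
  where
  E P X Y : ℕ
  E = ↧ₙ ε
  P = D ^ r * E
  X = r ! * Q * E
  Y = suc e * D ^ r
  P≢0 : NonZero P
  P≢0 = m*n≢0 (D ^ r) E {{m^n≢0 D r}}
  c*P≡X : c ℚ.* ℕ→ℚ P ≡ ℕ→ℚ X
  c*P≡X = begin
    c ℚ.* ℕ→ℚ (D ^ r * E)          ≡⟨ cong (c ℚ.*_) (ℕ→ℚ-* (D ^ r) E) ⟩
    c ℚ.* (ℕ→ℚ (D ^ r) ℚ.* ℕ→ℚ E)  ≡⟨ ℚ.*-assoc c (ℕ→ℚ (D ^ r)) (ℕ→ℚ E) ⟨
    c ℚ.* ℕ→ℚ (D ^ r) ℚ.* ℕ→ℚ E    ≡⟨ cong (ℚ._* ℕ→ℚ E) c*D^r≡r!*Q ⟩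
    ℕ→ℚ (r ! * Q) ℚ.* ℕ→ℚ E        ≡⟨ ℕ→ℚ-* (r ! * Q) E ⟨
    ℕ→ℚ X                          ∎
    where open ≡-Reasoning
  ε*P≡Y : ε ℚ.* ℕ→ℚ P ≡ ℕ→ℚ Y
  ε*P≡Y = begin
    ε ℚ.* ℕ→ℚ (D ^ r * E)          ≡⟨ cong (ε ℚ.*_) (ℕ→ℚ-* (D ^ r) E) ⟩
    ε ℚ.* (ℕ→ℚ (D ^ r) ℚ.* ℕ→ℚ E)  ≡⟨ solve 3 (λ ε d E → ε :* (d :* E) := (ε :* E) :* d) refl ε (ℕ→ℚ (D ^ r)) (ℕ→ℚ E) ⟩
    ε ℚ.* ℕ→ℚ E ℚ.* ℕ→ℚ (D ^ r)    ≡⟨ cong (ℚ._* ℕ→ℚ (D ^ r)) (*-↧ₙ≡↥ ε ↥ε≡1+e) ⟩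
    ℕ→ℚ (suc e) ℚ.* ℕ→ℚ (D ^ r)    ≡⟨ ℕ→ℚ-* (suc e) (D ^ r) ⟨
    ℕ→ℚ Y                          ∎
    where
    open ≡-Reasoning
    open ℚ-Solver
  X*C≤P*M+Y*C : ∀ {C t M} → r ! * (Q * E) * C ≤ Q * E * D ^ r * t ^ r + D ^ r * C → Q * t ^ r ≤ M →
    X * C ≤ P * M + Y * C
  X*C≤P*M+Y*C {C} {t} {M} bound Q*t^r≤M = begin
    X * C                              ≡⟨ cong (_* C) (*-assoc (r !) Q E) ⟩
    r ! * (Q * E) * C                  ≤⟨ bound ⟩
    Q * E * D ^ r * t ^ r + D ^ r * C  ≡⟨ cong (_+ D ^ r * C) (solve 4 (λ Q E d T → Q :* E :* d :* T := d :* E :* (Q :* T))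
                                                                 refl Q E (D ^ r) (t ^ r)) ⟩
    P * (Q * t ^ r) + D ^ r * C        ≤⟨ +-mono-≤ (*-monoʳ-≤ P Q*t^r≤M) (m≤n*m (D ^ r * C) (suc e)) ⟩
    P * M + suc e * (D ^ r * C)        ≡⟨ cong (P * M +_) (*-assoc (suc e) (D ^ r) C) ⟨
    P * M + Y * C                      ∎
    where
    open ≤-Reasoning
    open +-*-Solver

lemma5p4 : (r k : ℕ) → 2 ≤ r → 1 ≤ k →
    (𝓕 : List ℕ → Set) → (∀ λs → 𝓕 λs → TentPartition r k λs) →
    (L : ℕ → Set) → (∀ i → L i → i < k) →
    (n : ℕ) (H : Hypergraph r n) → LIntersecting L H →
    ((m : ℕ) → IsEx r 𝓕 n m → numEdges H ≤ m) × b≤π 𝓕 H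
lemma5p4 r k _ _ 𝓕 𝓕-tents L L<k n H H-L = numEdges≤ex , blowUpDensity≤π
  where
  numEdges≤ex : (m : ℕ) → IsEx r 𝓕 n m → numEdges H ≤ m
  numEdges≤ex m (_ , maximal) = maximal H (LIntersecting⇒Free L<k {H = H} H-L 𝓕-tents)

  blowUpDensity≤π : b≤π 𝓕 H
  blowUpDensity≤π y (y≥0 , Σy≡1) with commonDenominator y y≥0
  ... | D , D≢0 , a , a≡yD =
    ex≥Q⌊n/D⌋^r⇒≤π c (lagPolyℕ H a) D c*D^r≡r!*Q
      (λ n _ → IsEx⇒lagPolyℕ*⌊n/D⌋^r≤ L<k 𝓕-tents {H = H} H-L a Σa≡D n)
    where
    instance
      D-nonZero : NonZero D
      D-nonZero = D≢0
    c : ℚ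
    c = ℕ→ℚ (r !) ℚ.* lagPoly H y
    c*D^r≡r!*Q : c ℚ.* ℕ→ℚ (D ^ r) ≡ ℕ→ℚ (r ! * lagPolyℕ H a)
    c*D^r≡r!*Q = trans (ℚ.*-assoc (ℕ→ℚ (r !)) (lagPoly H y) (ℕ→ℚ (D ^ r)))
      (trans (cong (ℕ→ℚ (r !) ℚ.*_) (lagPoly-scaled H D a a≡yD)) (sym (ℕ→ℚ-* (r !) (lagPolyℕ H a))))
    Σa≡D : Vec.sum a ≡ D
    Σa≡D = ℕ→ℚ-injective
      (trans (sym (simplexSum-scaled D a a≡yD)) (trans (cong (ℚ._* ℕ→ℚ D) Σy≡1) (ℚ.*-identityˡ (ℕ→ℚ D))))
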